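{- Let $\epsilon=(\epsilon(1),\dots,\epsilon(k))$ be a Catalan sequence. Then there exists a unique non-crossing pairing $\sigma$ of $\{1,\dots,k\}$ compatible with $\epsilon$ such that $R\preceq v$ for every vertex $v$ of the quotient tree $T_\sigma$, where $R$ is the root of $T_\sigma$.
   Context: A sequence $\epsilon=(\epsilon(1),\dots,\epsilon(k))$ is a Catalan sequence if $\epsilon(i)\in\{ -1,+1\}$, $\epsilon(1)+\cdots+\epsilon(k)=0$ and $\epsilon(1)+\cdots+\epsilon(j)\geq 0$ for all $1\leq j\leq k$. Let $G_\epsilon$ be the oriented $k$-gon with vertices $v_1,\dots,v_k$ and edges $e_1,\dots,e_k$, $e_i$ joining $v_i$ and $v_{i+1}$ ($v_{k+1}:=v_1$), oriented from $v_{i+1}$ to $v_i$ if $\epsilon(i)=+1$ and from $v_i$ to $v_{i+1}$ if $\epsilon(i)=-1$. A pairing $\sigma$ of $\{1,\dots,k\}$ (partition into 2-element blocks) is compatible with $\epsilon$ if $\epsilon(i)+\epsilon(j)=0$ for all $\{i,j\}\in\sigma$, and non-crossing if there are no $p<q<r<s$ with $\{p,r\},\{q,s\}\in\sigma$. The quotient $T_\sigma$ is obtained by gluing, for each $\{i,j\}\in\sigma$, $e_i$ to $e_j$ identifying $v_i$ with $v_{j+1}$ and $v_{i+1}$ with $v_j$; edges inherit orientations. For non-crossing $\sigma$ it is a tree; its root $R$ is the image of $v_1$. For vertices $x,y$, $x\prec y$ means there is a nonempty directed path from $y$ to $x$ following the arrows, and $x\preceq y$ means $x\prec y$ or $x=y$.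 -}

module Defs where

open import Data.Nat as ℕ using (ℕ; zero; suc)
open import Data.Nat.DivMod using (_mod_)
open import Data.Fin using (Fin; toℕ)
open import Data.Integer as ℤ using (ℤ; +_; 0ℤ; 1ℤ; -1ℤ)
open import Data.List using (List; map; take; foldr; allFin)
open import Data.Product using (Σ; ∃; _×_; _,_)
open import Data.Sum using (_⊎_)
open import Relation.Nullary using (¬_)
open import Relation.Binary.PropositionalEquality using (_≡_)
open import Relation.Binary.Construct.Closure.Equivalence using (EqClosure)
open import Relation.Binary.Construct.Closure.Transitive using (TransClosure)

-- Indices are 0-based: vertex v_{i+1} / edge e_{i+1} of the paper is i : Fin k.
-- Cyclic successor (v_{k+1} := v_1).
next : ∀ {k} → Fin k → Fin k
next {suc m} i = suc (toℕ i) mod suc m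

psum : ∀ {k} → (Fin k → ℤ) → ℕ → ℤ
psum {k} ε j = foldr ℤ._+_ 0ℤ (map ε (take j (allFin k)))

IsCatalan : (k : ℕ) → (Fin k → ℤ) → Set
IsCatalan k ε =
  (∀ i → ε i ≡ 1ℤ ⊎ ε i ≡ -1ℤ)
  × psum ε k ≡ 0ℤ
  × (∀ j → 1 ℕ.≤ j → j ℕ.≤ k → 0ℤ ℤ.≤ psum ε j)

record Pairing (k : ℕ) : Set where
  field
    partner : Fin k → Fin k
    invol   : ∀ i → partner (partner i) ≡ i
    nofix   : ∀ i → ¬ (partner i ≡ i)
open Pairing public

Compatible : ∀ {k} → (Fin k → ℤ) → Pairing k → Set
Compatible ε σ = ∀ i → ε i ℤ.+ ε (partner σ i) ≡ 0ℤ

NonCrossing : ∀ {k} → Pairing k → Set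
NonCrossing {k} σ = ¬ (Σ (Fin k) λ p → Σ (Fin k) λ q → Σ (Fin k) λ r → Σ (Fin k) λ s →
  (toℕ p ℕ.< toℕ q) × (toℕ q ℕ.< toℕ r) × (toℕ r ℕ.< toℕ s)
  × partner σ p ≡ r × partner σ q ≡ s)

Glue : ∀ {k} → Pairing k → Fin k → Fin k → Set
Glue σ a b = ∃ λ i → (a ≡ i × b ≡ next (partner σ i)) ⊎ (a ≡ next i × b ≡ partner σ i)

-- Vertices of T_σ are classes of polygon vertices under this equivalence.
_∼[_]_ : ∀ {k} → Fin k → Pairing k → Fin k → Set
a ∼[ σ ] b = EqClosure (Glue σ) a b

Arrow : ∀ {k} → (Fin k → ℤ) → Pairing k → Fin k → Fin k → Set
Arrow ε σ a b = ∃ λ i →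
  (ε i ≡ 1ℤ × a ∼[ σ ] next i × b ∼[ σ ] i)
  ⊎ (ε i ≡ -1ℤ × a ∼[ σ ] i × b ∼[ σ ] next i)

Prec : ∀ {k} → (Fin k → ℤ) → Pairing k → Fin k → Fin k → Set
Prec ε σ x y = TransClosure (Arrow ε σ) y x

PrecEq : ∀ {k} → (Fin k → ℤ) → Pairing k → Fin k → Fin k → Set
PrecEq ε σ x y = Prec ε σ x y ⊎ x ∼[ σ ] y

RootMinimal : ∀ {k} → (Fin k → ℤ) → Pairing k → Set
RootMinimal {k} ε σ = ∀ (R : Fin k) → toℕ R ≡ 0 → ∀ (v : Fin k) → PrecEq ε σ R v

Good : ∀ {k} → (Fin k → ℤ) → Pairing k → Set
Good ε σ = NonCrossing σ × Compatible ε σ × RootMinimal ε σ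

{-# OPTIONS --safe #-}
-- Read ε as a Dyck path with height h(l) = ε(1)+⋯+ε(l) ≥ 0. The pairing σ joins each up-step a
-- to the down-step at which the path first returns to level h(a); these excursions are nested,
-- so σ is non-crossing and compatible. The vertex after step a is glued to σ(a): if a is a
-- down-step, σ(a) lies earlier at the same height, and if a is an up-step, σ(a) has an arrow to a
-- vertex of smaller height; so R ⪯ v by induction on (height, position).
-- Conversely, in any good pairing each up-step x is paired with a later step: were it paired with
-- j < x, the vertices v_{j+1}, …, v_x would be closed under gluing and under following arrows,
-- contain v_{j+1} and miss the root. Two non-crossing compatible pairings that both pair up-steps
-- forward agree, by induction on the distance from an up-step to its partner.
module Submission where

open import Defs
open import Data.Nat using (ℕ)
open import Data.Fin using (Fin)
open import Data.Integer using (ℤ)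
open import Data.Product using (Σ; _×_)
open import Relation.Binary.PropositionalEquality using (_≡_)

open import Algebra.Bundles using (AbelianGroup)
open import Data.Empty using (⊥; ⊥-elim)
open import Data.Fin as Fin using (toℕ; fromℕ<; inject₁)
open import Data.Fin.Properties using (toℕ-injective; toℕ-fromℕ<; toℕ<n; toℕ-inject₁)
open import Data.Integer as ℤ using (+_; 0ℤ; 1ℤ; -1ℤ; -_; ∣_∣)
import Data.Integer.Properties as ℤₚ
open import Data.List using (foldr; map; take; tabulate; allFin)
open import Data.List.Properties using (map-tabulate; take-map; map-∘)
open import Data.Nat using (zero; suc; z≤n; s≤s; _≤_; _<_; _+_; _≤?_; _<?_)
open import Data.Nat.DivMod using (_%_; m%n<n; m<n⇒m%n≡m; n%n≡0)
open import Data.Nat.Induction using (<-rec)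
open import Data.Nat.Properties
open import Data.Product using (∃; _,_; proj₁; proj₂)
open import Data.Sum as Sum using (_⊎_; inj₁; inj₂; [_,_]′)
open import Function using (id; _∘_)
open import Relation.Binary.Construct.Closure.Equivalence as EqClosure using ()
open import Relation.Binary.Construct.Closure.ReflexiveTransitive as Star using (_◅_)
open import Relation.Binary.Construct.Closure.Symmetric using (fwd; bwd)
open import Relation.Binary.Construct.Closure.Transitive using (TransClosure; [_]; _∷_)
open import Relation.Binary.Definitions using (tri<; tri≈; tri>)
open import Relation.Binary.PropositionalEquality using (refl; sym; trans; cong; subst; subst₂; _≢_; module ≡-Reasoning)
open import Relation.Nullary using (¬_; yes; no; _×-dec_)
open import Relation.Unary using (Decidable)

open import Algebra.Properties.Group (AbelianGroup.group ℤₚ.+-0-abelianGroup) using (inverseʳ-unique)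

psum-suc : ∀ {n} (ε : Fin (suc n) → ℤ) j → psum ε (suc j) ≡ ε Fin.zero ℤ.+ psum (ε ∘ Fin.suc) j
psum-suc {n} ε j = cong (λ xs → ε Fin.zero ℤ.+ foldr ℤ._+_ 0ℤ xs) (begin
  map ε (take j (tabulate Fin.suc))            ≡⟨ cong (map ε ∘ take j) (map-tabulate id Fin.suc) ⟨
  map ε (take j (map Fin.suc (allFin n)))      ≡⟨ cong (map ε) (take-map j (allFin n)) ⟩
  map ε (map Fin.suc (take j (allFin n)))      ≡⟨ map-∘ (take j (allFin n)) ⟨
  map (ε ∘ Fin.suc) (take j (allFin n))        ∎)
  where open ≡-Reasoning

psum-snoc : ∀ {n} (ε : Fin n → ℤ) (x : Fin n) → psum ε (suc (toℕ x)) ≡ psum ε (toℕ x) ℤ.+ ε x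
psum-snoc ε Fin.zero = ℤₚ.+-comm (ε Fin.zero) 0ℤ
psum-snoc ε (Fin.suc x) = begin
  psum ε (suc (suc (toℕ x)))                     ≡⟨ psum-suc ε (suc (toℕ x)) ⟩
  ε₀ ℤ.+ psum ε₊ (suc (toℕ x))                   ≡⟨ cong (λ t → ε₀ ℤ.+ t) (psum-snoc ε₊ x) ⟩
  ε₀ ℤ.+ (psum ε₊ (toℕ x) ℤ.+ ε (Fin.suc x))     ≡⟨ ℤₚ.+-assoc ε₀ _ (ε (Fin.suc x)) ⟨
  ε₀ ℤ.+ psum ε₊ (toℕ x) ℤ.+ ε (Fin.suc x)       ≡⟨ cong (λ t → t ℤ.+ ε (Fin.suc x)) (psum-suc ε (toℕ x)) ⟨
  psum ε (suc (toℕ x)) ℤ.+ ε (Fin.suc x)         ∎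
  where
  open ≡-Reasoning
  ε₀ : ℤ
  ε₀ = ε Fin.zero
  ε₊ : Fin _ → ℤ
  ε₊ = ε ∘ Fin.suc

module _ {P : ℕ → Set} (P? : Decidable P) where

  minimal-witness : ∀ n → P n → ∃ λ j → P j × j ≤ n × (∀ l → l < j → ¬ P l)
  minimal-witness = <-rec _ search
    where
    search : ∀ n → (∀ {l} → l < n → P l → ∃ λ j → P j × j ≤ l × (∀ i → i < j → ¬ P i)) →
             P n → ∃ λ j → P j × j ≤ n × (∀ l → l < j → ¬ P l)
    search n earlier pn with anyUpTo? P? n
    ... | no none = n , pn , ≤-refl , λ l l<n pl → none (l , l<n , pl)
    ... | yes (l , l<n , pl) with earlier l<n pl
    ...   | j , pj , j≤l , below = j , pj , ≤-trans j≤l (<⇒≤ l<n) , below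

  maximal-witness : ∀ n → P 0 → ∃ λ j → P j × j ≤ n × (∀ l → j < l → l ≤ n → ¬ P l)
  maximal-witness zero p0 = 0 , p0 , z≤n , λ l 0<l l≤0 _ → <⇒≱ 0<l l≤0
  maximal-witness (suc n) p0 with P? (suc n)
  ... | yes pn = suc n , pn , ≤-refl , λ l n<l l≤n _ → <⇒≱ n<l l≤n
  ... | no ¬pn with maximal-witness n p0
  ...   | j , pj , j≤n , above = j , pj , m≤n⇒m≤1+n j≤n , λ l j<l l≤1+n → not-above l j<l (m≤n⇒m<n∨m≡n l≤1+n)
    where
    not-above : ∀ l → j < l → l < suc n ⊎ l ≡ suc n → ¬ P l
    not-above l j<l (inj₁ l<1+n) = above l j<l (m<1+n⇒m≤n l<1+n)
    not-above _ _   (inj₂ refl)  = ¬pn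

lexicographic-induction : {A : Set} (f g : A → ℕ) (P : A → Set) →
  (∀ a → (∀ b → f b < f a → P b) → (∀ b → f b ≡ f a → g b < g a → P b) → P a) →
  ∀ a → P a
lexicographic-induction f g P step a = <-rec (λ n → ∀ a → f a ≡ n → P a) outer (f a) a refl
  where
  outer : ∀ n → (∀ {n'} → n' < n → ∀ a → f a ≡ n' → P a) → ∀ a → f a ≡ n → P a
  outer n lower a fa≡n = <-rec (λ p → ∀ a → f a ≡ n → g a ≡ p → P a) inner (g a) a fa≡n refl
    where
    inner : ∀ p → (∀ {p'} → p' < p → ∀ a → f a ≡ n → g a ≡ p' → P a) → ∀ a → f a ≡ n → g a ≡ p → P a
    inner p earlier a fa≡n ga≡p = step a
      (λ b fb<fa → lower (subst (f b <_) fa≡n fb<fa) b refl)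
      (λ b fb≡fa gb<ga → earlier (subst (g b <_) ga≡p gb<ga) b (trans fb≡fa fa≡n) refl)

toℕ-next-mod : ∀ {m} (i : Fin (suc m)) → toℕ (next i) ≡ suc (toℕ i) % suc m
toℕ-next-mod {m} i = toℕ-fromℕ< (m%n<n (suc (toℕ i)) (suc m))

toℕ-next : ∀ {m} (i : Fin (suc m)) → suc (toℕ i) < suc m → toℕ (next i) ≡ suc (toℕ i)
toℕ-next i i+1<k = trans (toℕ-next-mod i) (m<n⇒m%n≡m i+1<k)

toℕ-next-cases : ∀ {m} (i : Fin (suc m)) →
  toℕ (next i) ≡ suc (toℕ i) ⊎ (toℕ (next i) ≡ 0 × suc (toℕ i) ≡ suc m)
toℕ-next-cases {m} i with m≤n⇒m<n∨m≡n (toℕ<n i)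
... | inj₁ i+1<k = inj₁ (toℕ-next i i+1<k)
... | inj₂ i+1≡k = inj₂ (trans (toℕ-next-mod i) (trans (cong (_% suc m) i+1≡k) (n%n≡0 (suc m))) , i+1≡k)

toℕ-next-positive : ∀ {m} (i : Fin (suc m)) → 0 < toℕ (next i) → toℕ (next i) ≡ suc (toℕ i)
toℕ-next-positive i pos with toℕ-next-cases i
... | inj₁ eq       = eq
... | inj₂ (eq , _) = ⊥-elim (<-irrefl (sym eq) pos)

next-inject₁ : ∀ {m} (i : Fin m) → next (inject₁ i) ≡ Fin.suc i
next-inject₁ i = toℕ-injective (begin
  toℕ (next (inject₁ i))  ≡⟨ toℕ-next (inject₁ i) (s≤s (subst (_< _) (sym (toℕ-inject₁ i)) (toℕ<n i))) ⟩
  suc (toℕ (inject₁ i))   ≡⟨ cong suc (toℕ-inject₁ i) ⟩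
  suc (toℕ i)             ∎)
  where open ≡-Reasoning

Glue-sym : ∀ {k} (τ : Pairing k) {a b} → Glue τ a b → Glue τ b a
Glue-sym τ (i , inj₁ (refl , refl)) = partner τ i , inj₂ (refl , sym (invol τ i))
Glue-sym τ (i , inj₂ (refl , refl)) = partner τ i , inj₁ (refl , cong next (sym (invol τ i)))

module Invariant {k} (ε : Fin k → ℤ) (τ : Pairing k) (P : Fin k → Set)
  (glue : ∀ {a b} → Glue τ a b → P a → P b)
  (up : ∀ i → ε i ≡ 1ℤ → P (next i) → P i)
  (down : ∀ i → ε i ≡ -1ℤ → P i → P (next i)) where

  ∼-preserves : ∀ {a b} → a ∼[ τ ] b → P a → P b
  ∼-preserves Star.ε       = id
  ∼-preserves (fwd g ◅ gs) = ∼-preserves gs ∘ glue g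
  ∼-preserves (bwd g ◅ gs) = ∼-preserves gs ∘ glue (Glue-sym τ g)

  ∼-reflects : ∀ {a b} → a ∼[ τ ] b → P b → P a
  ∼-reflects = ∼-preserves ∘ EqClosure.symmetric (Glue τ)

  Arrow-preserves : ∀ {a b} → Arrow ε τ a b → P a → P b
  Arrow-preserves (i , inj₁ (εi , a∼i+1 , b∼i)) = ∼-reflects b∼i ∘ up i εi ∘ ∼-preserves a∼i+1
  Arrow-preserves (i , inj₂ (εi , a∼i , b∼i+1)) = ∼-reflects b∼i+1 ∘ down i εi ∘ ∼-preserves a∼i

  TransClosure-preserves : ∀ {a b} → TransClosure (Arrow ε τ) a b → P a → P b
  TransClosure-preserves [ a→b ]       = Arrow-preserves a→b
  TransClosure-preserves (a→c ∷ c→⁺b) = TransClosure-preserves c→⁺b ∘ Arrow-preserves a→c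

  PrecEq-downward : ∀ {x y} → PrecEq ε τ x y → P y → P x
  PrecEq-downward (inj₁ y→⁺x) = TransClosure-preserves y→⁺x
  PrecEq-downward (inj₂ x∼y)  = ∼-reflects x∼y

module _ {k} {ε : Fin k → ℤ} {τ : Pairing k} where

  private
    ∼-sym : ∀ {a b} → a ∼[ τ ] b → b ∼[ τ ] a
    ∼-sym = EqClosure.symmetric (Glue τ)
    ∼-trans : ∀ {a b c} → a ∼[ τ ] b → b ∼[ τ ] c → a ∼[ τ ] c
    ∼-trans = EqClosure.transitive (Glue τ)

  Arrow-respˡ-∼ : ∀ {a a' b} → a' ∼[ τ ] a → Arrow ε τ a b → Arrow ε τ a' b
  Arrow-respˡ-∼ a'∼a (i , inj₁ (εi , a∼ , b∼)) = i , inj₁ (εi , ∼-trans a'∼a a∼ , b∼)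
  Arrow-respˡ-∼ a'∼a (i , inj₂ (εi , a∼ , b∼)) = i , inj₂ (εi , ∼-trans a'∼a a∼ , b∼)

  Arrow-respʳ-∼ : ∀ {a b b'} → b ∼[ τ ] b' → Arrow ε τ a b → Arrow ε τ a b'
  Arrow-respʳ-∼ b∼b' (i , inj₁ (εi , a∼ , b∼)) = i , inj₁ (εi , a∼ , ∼-trans (∼-sym b∼b') b∼)
  Arrow-respʳ-∼ b∼b' (i , inj₂ (εi , a∼ , b∼)) = i , inj₂ (εi , a∼ , ∼-trans (∼-sym b∼b') b∼)

  PrecEq-respʳ-∼ : ∀ {R v w} → v ∼[ τ ] w → PrecEq ε τ R w → PrecEq ε τ R v
  PrecEq-respʳ-∼ v∼w (inj₁ [ w→R ])        = inj₁ [ Arrow-respˡ-∼ v∼w w→R ]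
  PrecEq-respʳ-∼ v∼w (inj₁ (w→u ∷ u→⁺R)) = inj₁ (Arrow-respˡ-∼ v∼w w→u ∷ u→⁺R)
  PrecEq-respʳ-∼ v∼w (inj₂ R∼w)            = inj₂ (∼-trans R∼w (∼-sym v∼w))

  PrecEq-arrow : ∀ {R v w} → Arrow ε τ v w → PrecEq ε τ R w → PrecEq ε τ R v
  PrecEq-arrow v→w (inj₁ w→⁺R) = inj₁ (v→w ∷ w→⁺R)
  PrecEq-arrow v→w (inj₂ R∼w)  = inj₁ [ Arrow-respʳ-∼ (∼-sym R∼w) v→w ]

partner-flip : ∀ {k} (τ : Pairing k) {x y} → partner τ x ≡ y → partner τ y ≡ x
partner-flip τ {x} τx≡y = trans (cong (partner τ) (sym τx≡y)) (invol τ x)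

partner-sign : ∀ {k} {ε : Fin k → ℤ} {τ : Pairing k} → Compatible ε τ → ∀ x → ε (partner τ x) ≡ - ε x
partner-sign compat x = inverseʳ-unique _ _ (compat x)

partner-nested : ∀ {k} {τ : Pairing k} → NonCrossing τ → ∀ {x y p} → partner τ x ≡ y →
  toℕ x < toℕ y → toℕ x < toℕ p → toℕ p < toℕ y →
  toℕ x < toℕ (partner τ p) × toℕ (partner τ p) < toℕ y
partner-nested {τ = τ} nc {x} {y} {p} τx≡y x<y x<p p<y with <-cmp (toℕ (partner τ p)) (toℕ x)
... | tri< τp<x _ _ = ⊥-elim (nc (partner τ p , x , p , y , τp<x , x<p , p<y , invol τ p , τx≡y))
... | tri≈ _ τp≡x _ =
  ⊥-elim (<-irrefl (cong toℕ (trans (sym (partner-flip τ (toℕ-injective τp≡x))) τx≡y)) p<y)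
... | tri> _ _ x<τp with <-cmp (toℕ (partner τ p)) (toℕ y)
...   | tri< τp<y _ _ = x<τp , τp<y
...   | tri≈ _ τp≡y _ =
  ⊥-elim (<-irrefl (cong toℕ (trans (sym (partner-flip τ τx≡y)) (partner-flip τ (toℕ-injective τp≡y)))) x<p)
...   | tri> _ _ y<τp = ⊥-elim (nc (x , p , y , partner τ p , x<p , p<y , y<τp , τx≡y , refl))

PairsForward : ∀ {k} → (Fin k → ℤ) → Pairing k → Set
PairsForward ε τ = ∀ x → ε x ≡ 1ℤ → toℕ x < toℕ (partner τ x)

module PartnerComparison {k} {ε : Fin k → ℤ} {τ τ' : Pairing k}
  (nc : NonCrossing τ) (compat : Compatible ε τ) (forward : PairsForward ε τ)
  (nc' : NonCrossing τ') (compat' : Compatible ε τ') (forward' : PairsForward ε τ') where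

  -- n bounds the τ'-distance from x to its partner; the pair (p, τ' p) nested inside it is closer.
  partner-≤ : ∀ n x → ε x ≡ 1ℤ → toℕ (partner τ' x) < toℕ x + n → toℕ (partner τ x) ≤ toℕ (partner τ' x)
  partner-≤ zero x εx bound =
    ⊥-elim (<-asym (forward' x εx) (subst (toℕ (partner τ' x) <_) (+-identityʳ (toℕ x)) bound))
  partner-≤ (suc n) x εx bound with toℕ (partner τ x) ≤? toℕ (partner τ' x)
  ... | yes j≤j' = j≤j'
  ... | no j≰j' = ⊥-elim (<-irrefl refl (≤-<-trans j'≤τ'p τ'p<j'))
    where
    j' p : Fin k
    j' = partner τ' x
    p = partner τ j'
    εp : ε p ≡ 1ℤ
    εp = trans (partner-sign {ε = ε} {τ = τ} compat j')
      (cong -_ (trans (partner-sign {ε = ε} {τ = τ'} compat' x) (cong -_ εx)))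
    τp≡j' : partner τ p ≡ j'
    τp≡j' = invol τ j'
    x<p : toℕ x < toℕ p
    x<p = proj₁ (partner-nested {τ = τ} nc refl (forward x εx) (forward' x εx) (≰⇒> j≰j'))
    τ'p<j' : toℕ (partner τ' p) < toℕ j'
    τ'p<j' = proj₂ (partner-nested {τ = τ'} nc' refl (forward' x εx) x<p
      (subst (λ t → toℕ p < toℕ t) τp≡j' (forward p εp)))
    bound-p : toℕ (partner τ' p) < toℕ p + n
    bound-p = <-≤-trans τ'p<j'
      (≤-trans (m<1+n⇒m≤n (subst (toℕ j' <_) (+-suc (toℕ x) n) bound)) (+-monoˡ-≤ n (<⇒≤ x<p)))
    j'≤τ'p : toℕ j' ≤ toℕ (partner τ' p)
    j'≤τ'p = subst (λ t → toℕ t ≤ toℕ (partner τ' p)) τp≡j' (partner-≤ n p εp bound-p)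

forward-pairing-unique : ∀ {k} {ε : Fin k → ℤ} {τ τ' : Pairing k} → (∀ i → ε i ≡ 1ℤ ⊎ ε i ≡ -1ℤ) →
  NonCrossing τ → Compatible ε τ → PairsForward ε τ →
  NonCrossing τ' → Compatible ε τ' → PairsForward ε τ' →
  ∀ x → partner τ x ≡ partner τ' x
forward-pairing-unique {ε = ε} {τ} {τ'} signs nc compat forward nc' compat' forward' x =
  [ up-unique x , down-unique ]′ (signs x)
  where
  distance-bound : ∀ t s → t < s + suc t
  distance-bound t s = <-≤-trans (n<1+n t) (m≤n+m (suc t) s)

  up-unique : ∀ x → ε x ≡ 1ℤ → partner τ x ≡ partner τ' x
  up-unique x εx = toℕ-injective (≤-antisym
    (PartnerComparison.partner-≤ {ε = ε} {τ} {τ'} nc compat forward nc' compat' forward' _ x εx (distance-bound _ _))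
    (PartnerComparison.partner-≤ {ε = ε} {τ'} {τ} nc' compat' forward' nc compat forward _ x εx (distance-bound _ _)))

  down-unique : ε x ≡ -1ℤ → partner τ x ≡ partner τ' x
  down-unique εx = sym (partner-flip τ' (trans (sym (up-unique y εy)) (invol τ x)))
    where
    y : Fin _
    y = partner τ x
    εy : ε y ≡ 1ℤ
    εy = trans (partner-sign {ε = ε} {τ = τ} compat x) (cong -_ εx)

module BackwardPair {m} {ε : Fin (suc m) → ℤ} {τ : Pairing (suc m)} (nc : NonCrossing τ)
  {x j : Fin (suc m)} (τx≡j : partner τ x ≡ j) (j<x : toℕ j < toℕ x) (εx : ε x ≡ 1ℤ) (εj : ε j ≡ -1ℤ) where

  -- The vertices between the edges j and x: v_{j+2}, …, v_{x+1} in the paper's 1-based numbering.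
  Between : Fin (suc m) → Set
  Between v = toℕ j < toℕ v × toℕ v ≤ toℕ x

  nested : ∀ {i} → toℕ j < toℕ i → toℕ i < toℕ x → toℕ j < toℕ (partner τ i) × toℕ (partner τ i) < toℕ x
  nested = partner-nested {τ = τ} nc (partner-flip τ τx≡j) j<x

  up≢down : ∀ {a b} → ε a ≡ 1ℤ → ε b ≡ -1ℤ → toℕ a ≢ toℕ b
  up≢down εa εb a≡b with trans (sym εa) (trans (cong ε (toℕ-injective a≡b)) εb)
  ... | ()

  Between-next : ∀ {i} → toℕ j ≤ toℕ i → toℕ i < toℕ x → Between (next i)
  Between-next {i} j≤i i<x = subst (λ t → toℕ j < t × t ≤ toℕ x) (sym i+1) (s≤s j≤i , i<x)
    where
    i+1 : toℕ (next i) ≡ suc (toℕ i)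
    i+1 = toℕ-next i (≤-<-trans i<x (toℕ<n x))

  Between-next⁻ : ∀ {i} → Between (next i) → toℕ j ≤ toℕ i × toℕ i < toℕ x
  Between-next⁻ {i} (j<i+1 , i+1≤x) = m<1+n⇒m≤n (subst (toℕ j <_) i+1 j<i+1) , subst (_≤ toℕ x) i+1 i+1≤x
    where
    i+1 : toℕ (next i) ≡ suc (toℕ i)
    i+1 = toℕ-next-positive i (≤-<-trans z≤n j<i+1)

  Between-glue : ∀ {a b} → Glue τ a b → Between a → Between b
  Between-glue (i , inj₁ (refl , refl)) (j<i , i≤x) with m≤n⇒m<n∨m≡n i≤x
  ... | inj₁ i<x = Between-next (<⇒≤ (proj₁ (nested j<i i<x))) (proj₂ (nested j<i i<x))
  ... | inj₂ i≡x = subst (Between ∘ next) (sym τi≡j) (Between-next ≤-refl j<x)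
    where
    τi≡j : partner τ i ≡ j
    τi≡j = trans (cong (partner τ) (toℕ-injective i≡x)) τx≡j
  Between-glue (i , inj₂ (refl , refl)) between with Between-next⁻ between
  ... | j≤i , i<x with m≤n⇒m<n∨m≡n j≤i
  ...   | inj₁ j<i = proj₁ (nested j<i i<x) , <⇒≤ (proj₂ (nested j<i i<x))
  ...   | inj₂ j≡i = subst Between (sym τi≡x) (j<x , ≤-refl)
    where
    τi≡x : partner τ i ≡ x
    τi≡x = trans (cong (partner τ) (sym (toℕ-injective j≡i))) (partner-flip τ τx≡j)

  Between-up : ∀ i → ε i ≡ 1ℤ → Between (next i) → Between i
  Between-up i εi between with Between-next⁻ between
  ... | j≤i , i<x = ≤∧≢⇒< j≤i (up≢down εi εj ∘ sym) , <⇒≤ i<x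

  Between-down : ∀ i → ε i ≡ -1ℤ → Between i → Between (next i)
  Between-down i εi (j<i , i≤x) = Between-next (<⇒≤ j<i) (≤∧≢⇒< i≤x (up≢down εx εi ∘ sym))

  root-not-below : ¬ PrecEq ε τ Fin.zero (next j)
  root-not-below root⪯ = n≮0 (proj₁ (PrecEq-downward root⪯ (Between-next ≤-refl j<x)))
    where open Invariant ε τ Between Between-glue Between-up Between-down

root-minimal⇒pairs-forward : ∀ {m} {ε : Fin (suc m) → ℤ} {τ : Pairing (suc m)} →
  NonCrossing τ → Compatible ε τ → RootMinimal ε τ → PairsForward ε τ
root-minimal⇒pairs-forward {ε = ε} {τ} nc compat root x εx with <-cmp (toℕ x) (toℕ (partner τ x))
... | tri< x<τx _ _ = x<τx
... | tri≈ _ x≡τx _ = ⊥-elim (nofix τ x (toℕ-injective (sym x≡τx)))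
... | tri> _ _ τx<x =
  ⊥-elim (BackwardPair.root-not-below {ε = ε} {τ = τ} nc refl τx<x εx ετx (root Fin.zero refl (next (partner τ x))))
  where
  ετx : ε (partner τ x) ≡ -1ℤ
  ετx = trans (partner-sign {ε = ε} {τ = τ} compat x) (cong -_ εx)

module Excursions (h : ℕ → ℕ) where

  Rise Fall : ℕ → Set
  Rise l = h (suc l) ≡ suc (h l)
  Fall l = h l ≡ suc (h (suc l))

  Matches : ℕ → ℕ → Set
  Matches a b = a < b × h a ≡ h (suc b) × (∀ {l} → a < l → l ≤ b → h a < h l)

  matches-rises : ∀ {a b} → Matches a b → h a < h (suc a)
  matches-rises (a<b , _ , above) = above (n<1+n _) a<b

  matches-falls : ∀ {a b} → Matches a b → h (suc b) < h b
  matches-falls {b = b} (a<b , level , above) = subst (_< h b) level (above a<b ≤-refl)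

  matches-injectiveˡ : ∀ {a a' b} → Matches a b → Matches a' b → a ≡ a'
  matches-injectiveˡ {a} {a'} (a<b , level , above) (a'<b , level' , above') with <-cmp a a'
  ... | tri< a<a' _ _ = ⊥-elim (<-irrefl (trans level (sym level')) (above a<a' (<⇒≤ a'<b)))
  ... | tri≈ _ a≡a' _ = a≡a'
  ... | tri> _ _ a'<a = ⊥-elim (<-irrefl (trans level' (sym level)) (above' a'<a (<⇒≤ a<b)))

  matches-injectiveʳ : ∀ {a b b'} → Matches a b → Matches a b' → b ≡ b'
  matches-injectiveʳ {a} {b} {b'} (a<b , level , above) (a<b' , level' , above') with <-cmp b b'
  ... | tri< b<b' _ _ = ⊥-elim (<-irrefl level (above' (m<n⇒m<1+n a<b) b<b'))
  ... | tri≈ _ b≡b' _ = b≡b'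
  ... | tri> _ _ b'<b = ⊥-elim (<-irrefl level' (above (m<n⇒m<1+n a<b') b'<b))

  matches-noncrossing : ∀ {p q r s} → Matches p r → Matches q s → p < q → q < r → r < s → ⊥
  matches-noncrossing (_ , level , above) (_ , _ , above') p<q q<r r<s =
    <-irrefl level (<-trans (above p<q (<⇒≤ q<r)) (above' (m<n⇒m<1+n q<r) r<s))

  module _ {m} (step : ∀ {l} → l ≤ m → Rise l ⊎ Fall l) where

    rise-before-end : h (suc m) ≡ 0 → ∀ {a} → a ≤ m → Rise a → a < m
    rise-before-end end a≤m rise = ≤∧≢⇒< a≤m (λ a≡m → 0≢1+n (trans (sym end) (subst Rise a≡m rise)))

    match-right : h (suc m) ≡ 0 → ∀ {a} → a ≤ m → Rise a → ∃ λ b → b ≤ m × Matches a b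
    match-right end {a} a≤m rise with minimal-witness (λ l → (a <? l) ×-dec (h (suc l) ≤? h a)) m
      (rise-before-end end a≤m rise , subst (_≤ h a) (sym end) z≤n)
    ... | b , (a<b , hb+1≤ha) , b≤m , earlier = b , b≤m , a<b , level , above
      where
      above : ∀ {l} → a < l → l ≤ b → h a < h l
      above {suc l} (s≤s a≤l) l<b with m≤n⇒m<n∨m≡n a≤l
      ... | inj₁ a<l  = ≰⇒> (λ hl+1≤ha → earlier l l<b (a<l , hl+1≤ha))
      ... | inj₂ refl = subst (h a <_) (sym rise) (n<1+n _)
      level : h a ≡ h (suc b)
      level with step b≤m
      ... | inj₁ rise-b = ⊥-elim (<-irrefl refl
        (<-≤-trans (<-trans (above a<b ≤-refl) (subst (h b <_) (sym rise-b) (n<1+n _))) hb+1≤ha))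
      ... | inj₂ fall-b = ≤-antisym (m<1+n⇒m≤n (subst (h a <_) fall-b (above a<b ≤-refl))) hb+1≤ha

    match-left : h 0 ≡ 0 → ∀ {b} → b ≤ m → Fall b → ∃ λ a → Matches a b
    match-left start {b} b≤m fall
      with maximal-witness (λ i → h i ≤? h (suc b)) b (subst (_≤ h (suc b)) (sym start) z≤n)
    ... | a , ha≤hb+1 , a≤b , later = a , a<b , level , above
      where
      above-end : ∀ {l} → a < l → l ≤ b → h (suc b) < h l
      above-end a<l l≤b = ≰⇒> (later _ a<l l≤b)
      above : ∀ {l} → a < l → l ≤ b → h a < h l
      above a<l l≤b = ≤-<-trans ha≤hb+1 (above-end a<l l≤b)
      a<b : a < b
      a<b = ≤∧≢⇒< a≤b λ a≡b →
        1+n≰n (subst (_≤ h (suc b)) fall (subst (λ i → h i ≤ h (suc b)) a≡b ha≤hb+1))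
      level : h a ≡ h (suc b)
      level with step (≤-trans (<⇒≤ a<b) b≤m)
      ... | inj₁ rise-a =
        ≤-antisym ha≤hb+1 (m<1+n⇒m≤n (subst (h (suc b) <_) rise-a (above-end (n<1+n a) a<b)))
      ... | inj₂ fall-a = ⊥-elim (<-irrefl refl
        (<-≤-trans (<-trans (above-end (n<1+n a) a<b) (subst (h (suc a) <_) (sym fall-a) (n<1+n _))) ha≤hb+1))

module Catalan {m} {ε : Fin (suc m) → ℤ} (catalan : IsCatalan (suc m) ε) where

  signs : ∀ i → ε i ≡ 1ℤ ⊎ ε i ≡ -1ℤ
  signs = proj₁ catalan

  -- ∣_∣ is harmless: the partial sums are nonnegative (psum≡height).
  height : ℕ → ℕ
  height l = ∣ psum ε l ∣

  open Excursions height

  psum≡height : ∀ {l} → l ≤ suc m → psum ε l ≡ + height l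
  psum≡height {zero}  _   = refl
  psum≡height {suc l} l<k = sym (ℤₚ.0≤i⇒+∣i∣≡i (proj₂ (proj₂ catalan) (suc l) (s≤s z≤n) l<k))

  height-end : height (suc m) ≡ 0
  height-end = cong ∣_∣ (proj₁ (proj₂ catalan))

  height-snoc : ∀ x → + height (suc (toℕ x)) ≡ + height (toℕ x) ℤ.+ ε x
  height-snoc x = begin
    + height (suc (toℕ x))      ≡⟨ psum≡height (toℕ<n x) ⟨
    psum ε (suc (toℕ x))        ≡⟨ psum-snoc ε x ⟩
    psum ε (toℕ x) ℤ.+ ε x      ≡⟨ cong (λ t → t ℤ.+ ε x) (psum≡height (<⇒≤ (toℕ<n x))) ⟩
    + height (toℕ x) ℤ.+ ε x    ∎
    where open ≡-Reasoning

  up⇒Rise : ∀ x → ε x ≡ 1ℤ → Rise (toℕ x)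
  up⇒Rise x εx = trans (ℤₚ.+-injective (trans (height-snoc x) (cong (λ t → + height (toℕ x) ℤ.+ t) εx)))
    (+-comm (height (toℕ x)) 1)

  down⇒Fall : ∀ x → ε x ≡ -1ℤ → Fall (toℕ x)
  down⇒Fall x εx = trans (ℤₚ.+-injective (begin
    + height (toℕ x)                      ≡⟨ ℤₚ.+-identityʳ _ ⟨
    + height (toℕ x) ℤ.+ (-1ℤ ℤ.+ 1ℤ)     ≡⟨ ℤₚ.+-assoc (+ height (toℕ x)) -1ℤ 1ℤ ⟨
    + height (toℕ x) ℤ.+ -1ℤ ℤ.+ 1ℤ       ≡⟨ cong (λ t → + height (toℕ x) ℤ.+ t ℤ.+ 1ℤ) εx ⟨
    + height (toℕ x) ℤ.+ ε x ℤ.+ 1ℤ       ≡⟨ cong (λ t → t ℤ.+ 1ℤ) (height-snoc x) ⟨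
    + height (suc (toℕ x)) ℤ.+ 1ℤ         ∎)) (+-comm (height (suc (toℕ x))) 1)
    where open ≡-Reasoning

  unit-step : ∀ {l} → l ≤ m → Rise l ⊎ Fall l
  unit-step l≤m = subst (λ l → Rise l ⊎ Fall l) (toℕ-fromℕ< (s≤s l≤m)) (step (fromℕ< (s≤s l≤m)))
    where
    step : ∀ x → Rise (toℕ x) ⊎ Fall (toℕ x)
    step x = Sum.map (up⇒Rise x) (down⇒Fall x) (signs x)

  rises⇒up : ∀ x → height (toℕ x) < height (suc (toℕ x)) → ε x ≡ 1ℤ
  rises⇒up x rises with signs x
  ... | inj₁ εx = εx
  ... | inj₂ εx = ⊥-elim (<-asym rises (subst (height (suc (toℕ x)) <_) (sym (down⇒Fall x εx)) (n<1+n _)))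

  falls⇒down : ∀ x → height (suc (toℕ x)) < height (toℕ x) → ε x ≡ -1ℤ
  falls⇒down x falls with signs x
  ... | inj₁ εx = ⊥-elim (<-asym falls (subst (height (toℕ x) <_) (sym (up⇒Rise x εx)) (n<1+n _)))
  ... | inj₂ εx = εx

  matches-signs : ∀ {x y} → Matches (toℕ x) (toℕ y) → ε x ≡ 1ℤ × ε y ≡ -1ℤ
  matches-signs {x} {y} M = rises⇒up x (matches-rises M) , falls⇒down y (matches-falls M)

  partner-up : ∀ x → ε x ≡ 1ℤ → ∃ λ y → Matches (toℕ x) (toℕ y)
  partner-up x εx with match-right unit-step height-end (m<1+n⇒m≤n (toℕ<n x)) (up⇒Rise x εx)
  ... | b , b≤m , M = fromℕ< (s≤s b≤m) , subst (Matches (toℕ x)) (sym (toℕ-fromℕ< (s≤s b≤m))) M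

  partner-down : ∀ y → ε y ≡ -1ℤ → ∃ λ x → Matches (toℕ x) (toℕ y)
  partner-down y εy with match-left unit-step refl (m<1+n⇒m≤n (toℕ<n y)) (down⇒Fall y εy)
  ... | a , M = fromℕ< a<k , subst (λ a → Matches a (toℕ y)) (sym (toℕ-fromℕ< a<k)) M
    where
    a<k : a < suc m
    a<k = <-trans (proj₁ M) (toℕ<n y)

  match : Fin (suc m) → Fin (suc m)
  match x with signs x
  ... | inj₁ εx = proj₁ (partner-up x εx)
  ... | inj₂ εx = proj₁ (partner-down x εx)

  match-spec : ∀ x → Matches (toℕ x) (toℕ (match x)) ⊎ Matches (toℕ (match x)) (toℕ x)
  match-spec x with signs x
  ... | inj₁ εx = inj₁ (proj₂ (partner-up x εx))
  ... | inj₂ εx = inj₂ (proj₂ (partner-down x εx))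

  match-up : ∀ x → ε x ≡ 1ℤ → Matches (toℕ x) (toℕ (match x))
  match-up x εx with match-spec x
  ... | inj₁ M = M
  ... | inj₂ M with trans (sym εx) (proj₂ (matches-signs M))
  ...   | ()

  match-down : ∀ y → ε y ≡ -1ℤ → Matches (toℕ (match y)) (toℕ y)
  match-down y εy with match-spec y
  ... | inj₂ M = M
  ... | inj₁ M with trans (sym (proj₁ (matches-signs M))) εy
  ...   | ()

  match-forward : ∀ x → toℕ x < toℕ (match x) → Matches (toℕ x) (toℕ (match x))
  match-forward x x<y with match-spec x
  ... | inj₁ M = M
  ... | inj₂ (y<x , _) = ⊥-elim (<-asym x<y y<x)

  match-involutive : ∀ x → match (match x) ≡ x
  match-involutive x with match-spec x
  ... | inj₁ M = toℕ-injective (matches-injectiveˡ (match-down (match x) (proj₂ (matches-signs M))) M)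
  ... | inj₂ M = toℕ-injective (sym (matches-injectiveʳ M (match-up (match x) (proj₁ (matches-signs M)))))

  match-nofix : ∀ x → match x ≢ x
  match-nofix x mx≡x with match-spec x
  ... | inj₁ (x<y , _) = <-irrefl (cong toℕ (sym mx≡x)) x<y
  ... | inj₂ (y<x , _) = <-irrefl (cong toℕ mx≡x) y<x

  σ : Pairing (suc m)
  σ = record { partner = match ; invol = match-involutive ; nofix = match-nofix }

  σ-compatible : Compatible ε σ
  σ-compatible x with match-spec x
  ... | inj₁ M = subst₂ (λ a b → a ℤ.+ b ≡ 0ℤ) (sym (proj₁ (matches-signs M))) (sym (proj₂ (matches-signs M))) refl
  ... | inj₂ M = subst₂ (λ a b → b ℤ.+ a ≡ 0ℤ) (sym (proj₁ (matches-signs M))) (sym (proj₂ (matches-signs M))) refl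

  σ-pairs-forward : PairsForward ε σ
  σ-pairs-forward x εx = proj₁ (match-up x εx)

  σ-noncrossing : NonCrossing σ
  σ-noncrossing (p , q , _ , _ , p<q , q<r , r<s , refl , refl) =
    matches-noncrossing (match-forward p (<-trans p<q q<r)) (match-forward q (<-trans q<r r<s)) p<q q<r r<s

  height-next : ∀ a → height (toℕ (next a)) ≡ height (suc (toℕ a))
  height-next a with toℕ-next-cases {m} a
  ... | inj₁ a+1 = cong height a+1
  ... | inj₂ (last , a+1≡k) = trans (cong height last) (trans (sym height-end) (cong height (sym a+1≡k)))

  σ-root-minimal : RootMinimal ε σ
  σ-root-minimal R R≡0 = lexicographic-induction (height ∘ toℕ) toℕ (PrecEq ε σ R) reduce
    where
    reduce : ∀ a → (∀ b → height (toℕ b) < height (toℕ a) → PrecEq ε σ R b) →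
      (∀ b → height (toℕ b) ≡ height (toℕ a) → toℕ b < toℕ a → PrecEq ε σ R b) → PrecEq ε σ R a
    reduce Fin.zero _ _ = inj₂ (subst (λ t → R ∼[ σ ] t) (toℕ-injective R≡0) Star.ε)
    reduce (Fin.suc a) lower earlier =
      PrecEq-respʳ-∼ {ε = ε} {τ = σ} (fwd (b , inj₂ (sym (next-inject₁ a) , refl)) ◅ Star.ε) (from-match (signs b))
      where
      b : Fin (suc m)
      b = inject₁ a
      height-b+1 : height (suc (toℕ b)) ≡ height (suc (toℕ a))
      height-b+1 = cong (height ∘ suc) (toℕ-inject₁ a)
      from-match : ε b ≡ 1ℤ ⊎ ε b ≡ -1ℤ → PrecEq ε σ R (match b)
      from-match (inj₁ εb) = PrecEq-arrow {ε = ε} {τ = σ} (match b , inj₂ (proj₂ (matches-signs M) , Star.ε , Star.ε))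
                                          (lower (next (match b)) lower-height)
        where
        M : Matches (toℕ b) (toℕ (match b))
        M = match-up b εb
        lower-height : height (toℕ (next (match b))) < height (suc (toℕ a))
        lower-height = begin-strict
          height (toℕ (next (match b)))    ≡⟨ height-next (match b) ⟩
          height (suc (toℕ (match b)))     ≡⟨ proj₁ (proj₂ M) ⟨
          height (toℕ b)                   <⟨ n<1+n _ ⟩
          suc (height (toℕ b))             ≡⟨ up⇒Rise b εb ⟨
          height (suc (toℕ b))             ≡⟨ height-b+1 ⟩
          height (suc (toℕ a))             ∎
          where open ≤-Reasoning
      from-match (inj₂ εb) = earlier (match b) (trans (proj₁ (proj₂ M)) height-b+1)
                                     (<-trans (proj₁ M) (s≤s (≤-reflexive (toℕ-inject₁ a))))
        where
        M : Matches (toℕ (match b)) (toℕ b)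
        M = match-down b εb

lemma2p1 : (k : ℕ) (ε : Fin k → ℤ) → IsCatalan k ε →
    Σ (Pairing k) λ σ → Good ε σ ×
    ((τ : Pairing k) → Good ε τ → ∀ i → partner τ i ≡ partner σ i)
lemma2p1 zero ε _ =
  record { partner = λ () ; invol = λ () ; nofix = λ () } , ((λ { (() , _) }) , (λ ()) , (λ ())) , λ _ _ ()
lemma2p1 (suc m) ε catalan = σ , (σ-noncrossing , σ-compatible , σ-root-minimal) , unique
  where
  open Catalan {m} {ε} catalan
  unique : (τ : Pairing (suc m)) → Good ε τ → ∀ i → partner τ i ≡ partner σ i
  unique τ (nc , compat , root) =
    forward-pairing-unique {τ = τ} {τ' = σ} signs nc compat (root-minimal⇒pairs-forward {τ = τ} nc compat root)
      σ-noncrossing σ-compatible σ-pairs-forward
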